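{- Let $m\ge1$ and let $C\subseteq\mathbb{F}_2^N$ be a binary self-orthogonal linear code containing the all-ones vector $\mathbf 1$. Then $\mathrm{cwe}(C(m))=\sum_{D}\mu_m(D)$, where $D$ runs over all linear subcodes with $\mathbf 1\in D\subseteq C$.
   Context: Identify $\mathbb{F}_{2^m}$ with $\mathbb{F}_2^{\,m}$ via a fixed $\mathbb{F}_2$-basis and work in $\mathbb{R}[x_v:v\in\mathbb{F}_2^{\,m}]$. For a binary linear code $C\subseteq\mathbb{F}_2^N$, $C(m)=C\otimes_{\mathbb{F}_2}\mathbb{F}_{2^m}$ and $\mathrm{cwe}(C(m))=\sum_{c\in C(m)}\prod_{v}x_v^{a_v(c)}$, with $a_v(c)$ the number of coordinates of $c$ equal to $v$. For an $m\times N$ matrix $M$ over $\mathbb{F}_2$ let $\mu_M=\prod_{j=1}^Nx_{M^{(j)}}$, where $M^{(j)}\in\mathbb{F}_2^{\,m}$ is the $j$-th column of $M$. For a linear code $D\subseteq\mathbb{F}_2^N$, $\mu_m(D)=\sum\mu_M$, the sum over all $M\in\mathbb{F}_2^{m\times N}$ such that the span of the rows of $M$ together with $\mathbf 1$ equals $D$ (this is $0$ if $\mathbf 1\notin D$ or $\dim D>m+1$). -}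

module Defs where

open import Data.Bool using (Bool; true; false; _xor_; _∧_; _∨_; not; if_then_else_)
open import Data.Nat using (ℕ; zero; suc)
open import Data.Fin using (Fin)
open import Data.Vec as V using (Vec; []; _∷_)
open import Data.List as L using (List; []; _∷_)
open import Data.Bool.ListAction using (all; any)
open import Relation.Binary.PropositionalEquality using (_≡_)
open import Algebra.Bundles using (CommutativeSemiring)

-- F₂ = Bool (xor = addition, ∧ = multiplication); F₂ⁿ = Vec Bool n.

F2^ : ℕ → Set
F2^ n = Vec Bool n

vecsOver : ∀ {a} {A : Set a} → List A → (n : ℕ) → List (Vec A n)
vecsOver xs zero    = [] ∷ []
vecsOver xs (suc n) = L.concatMap (λ x → L.map (x ∷_) (vecsOver xs n)) xs

allVecs : (n : ℕ) → List (F2^ n)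
allVecs = vecsOver (false ∷ true ∷ [])

_==ᵇ_ : Bool → Bool → Bool
a ==ᵇ b = not (a xor b)

eqV : ∀ {n} → F2^ n → F2^ n → Bool
eqV []      []      = true
eqV (a ∷ u) (b ∷ v) = (a ==ᵇ b) ∧ eqV u v

zeroV : (n : ℕ) → F2^ n
zeroV n = V.replicate n false

onesV : (n : ℕ) → F2^ n
onesV n = V.replicate n true

_⊕_ : ∀ {n} → F2^ n → F2^ n → F2^ n
_⊕_ = V.zipWith _xor_

dot : ∀ {n} → F2^ n → F2^ n → Bool
dot []      []      = false
dot (a ∷ u) (b ∷ v) = (a ∧ b) xor dot u v

-- Binary codes: subsets of F₂ᴺ given by characteristic functions.

record IsLinearCode {N : ℕ} (C : F2^ N → Bool) : Set where
  field
    zero∈    : C (zeroV N) ≡ true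
    ⊕-closed : ∀ u v → C u ≡ true → C v ≡ true → C (u ⊕ v) ≡ true

SelfOrthogonal : ∀ {N} → (F2^ N → Bool) → Set
SelfOrthogonal C = ∀ u v → C u ≡ true → C v ≡ true → dot u v ≡ false

isLinearᵇ : ∀ {N} → (F2^ N → Bool) → Bool
isLinearᵇ {N} D =
  D (zeroV N) ∧
  all (λ u → all (λ v → not (D u) ∨ not (D v) ∨ D (u ⊕ v)) (allVecs N)) (allVecs N)

subsetᵇ : ∀ {N} → (F2^ N → Bool) → (F2^ N → Bool) → Bool
subsetᵇ {N} D C = all (λ u → not (D u) ∨ C u) (allVecs N)

-- all subsets of F₂ⁿ (each exactly once, as characteristic functions)
allSubsets : (n : ℕ) → List (F2^ n → Bool)
allSubsets zero    = L.map (λ b → λ _ → b) (false ∷ true ∷ [])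
allSubsets (suc n) =
  L.concatMap (λ f0 → L.map (λ f1 → glue f0 f1) (allSubsets n)) (allSubsets n)
  where
  glue : (F2^ n → Bool) → (F2^ n → Bool) → F2^ (suc n) → Bool
  glue f0 f1 (false ∷ v) = f0 v
  glue f0 f1 (true  ∷ v) = f1 v

subcodesWithOnes : ∀ {N} → (F2^ N → Bool) → List (F2^ N → Bool)
subcodesWithOnes {N} C =
  L.filterᵇ (λ D → isLinearᵇ D ∧ D (onesV N) ∧ subsetᵇ D C) (allSubsets N)

lincomb : ∀ {k n} → F2^ k → Vec (F2^ n) k → F2^ n
lincomb {n = n} []       []       = zeroV n
lincomb {n = n} (a ∷ as) (r ∷ rs) = (if a then r else zeroV n) ⊕ lincomb as rs

inSpanᵇ : ∀ {k n} → Vec (F2^ n) k → F2^ n → Bool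
inSpanᵇ {k} rs w = any (λ c → eqV (lincomb c rs) w) (allVecs k)

-- An m×N matrix M over F₂ is given by its m rows (Vec (F2^ N) m).
-- spanEqᵇ M D : span(rows of M, 𝟏) = D
spanEqᵇ : ∀ {m N} → Vec (F2^ N) m → (F2^ N → Bool) → Bool
spanEqᵇ {m} {N} M D = all (λ w → inSpanᵇ (onesV N ∷ M) w ==ᵇ D w) (allVecs N)

column : ∀ {m N} → Vec (F2^ N) m → Fin N → F2^ m
column M j = V.map (λ r → V.lookup r j) M

-- C(m) = C ⊗ F_{2^m} ⊆ (F_{2^m})ᴺ, with F_{2^m} ≅ F₂ᵐ (as additive groups,
-- via the fixed basis).  It is the F_{2^m}-span of C: the words
-- Σ_{c ∈ C} λ_c · c  (λ_c ∈ F_{2^m}), where (λ · c)_j = λ if c_j = 1, else 0.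

scaleWord : ∀ {m N} → F2^ m → F2^ N → Vec (F2^ m) N
scaleWord {m} l c = V.map (λ b → if b then l else zeroV m) c

tensorComb : ∀ {m N k} → Vec (F2^ m) k → Vec (F2^ N) k → Vec (F2^ m) N
tensorComb {m} {N} []       []       = V.replicate N (zeroV m)
tensorComb         (l ∷ ls) (c ∷ cs) = V.zipWith _⊕_ (scaleWord l c) (tensorComb ls cs)

inCmᵇ : ∀ {m N} → (F2^ N → Bool) → Vec (F2^ m) N → Bool
inCmᵇ {m} {N} C w =
  any (λ ls → all (λ j → eqV (V.lookup (tensorComb ls cs) j) (V.lookup w j)) (L.allFin N))
        (vecsOver (allVecs m) (L.length codewords))
  where
  codewords = L.filterᵇ C (allVecs N)
  cs = V.fromList codewords

count : ∀ {m N} → F2^ m → Vec (F2^ m) N → ℕ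
count v []      = zero
count v (u ∷ w) = if eqV v u then suc (count v w) else count v w

-- Polynomial identities in the variables x_v (v ∈ F₂ᵐ) are expressed by
-- evaluating at an arbitrary point x : F₂ᵐ → R of an arbitrary commutative
-- semiring R (all coefficients involved are natural numbers).

module Poly {c ℓ} (R : CommutativeSemiring c ℓ) where
  open CommutativeSemiring R

  sumL : List Carrier → Carrier
  sumL = L.foldr _+_ 0#

  prodL : List Carrier → Carrier
  prodL = L.foldr _*_ 1#

  pow : Carrier → ℕ → Carrier
  pow a zero    = 1#
  pow a (suc n) = a * pow a n

  module _ {m : ℕ} (x : F2^ m → Carrier) where

    monomial : ∀ {N} → Vec (F2^ m) N → Carrier
    monomial w = prodL (L.map (λ v → pow (x v) (count v w)) (allVecs m))

    cwe : ∀ {N} → (F2^ N → Bool) → Carrier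
    cwe {N} C = sumL (L.map monomial (L.filterᵇ (inCmᵇ C) (vecsOver (allVecs m) N)))

    μM : ∀ {N} → Vec (F2^ N) m → Carrier
    μM {N} M = prodL (L.map (λ j → x (column M j)) (L.allFin N))

    μ : ∀ {N} → (F2^ N → Bool) → Carrier
    μ {N} D = sumL (L.map μM (L.filterᵇ (λ M → spanEqᵇ M D) (vecsOver (allVecs N) m)))

    sumμSubcodes : ∀ {N} → (F2^ N → Bool) → Carrier
    sumμSubcodes C = sumL (L.map μ (subcodesWithOnes C))

-- Both sides equal the sum of μ_M over the m × N matrices M whose rows all lie in C.
-- Reading a word of (F_{2^m})^N as the sequence of columns of an m × N matrix M over F₂
-- turns its monomial into μ_M, and the word lies in C(m) exactly when the rows of M lie
-- in C.  On the other side, grouping the matrices by D = span(rows of M, 𝟏) counts each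
-- matrix once, and since 𝟏 ∈ C the condition D ⊆ C again says that the rows of M lie in C.
module Submission where

open import Defs
open import Algebra.Bundles using (CommutativeMonoid; CommutativeSemiring)
open import Data.Bool using (Bool; true; false; _xor_; _∧_; _∨_; not; if_then_else_)
open import Data.Bool.ListAction using (all; any)
open import Data.Bool.Properties
  using (T-≡; ⇔→≡; ∧-comm; ∧-commutativeMonoid; xor-assoc; xor-comm; xor-identityˡ; xor-identityʳ; xor-same)
open import Data.Fin using (Fin) renaming (zero to fzero; suc to fsuc)
open import Data.List as L using (List; []; _∷_; _++_)
open import Data.List.Membership.Propositional using (_∈_; lose)
open import Data.List.Membership.Propositional.Properties
  using (∈-map⁺; ∈-concatMap⁺; ∈-filter⁺; ∈-allFin)
import Data.List.Properties as LP
import Data.List.Relation.Unary.All as All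
open import Data.List.Relation.Unary.All.Properties using (all⁺; all⁻)
open import Data.List.Relation.Unary.Any as Any using (here; there)
open import Data.List.Relation.Unary.Any.Properties using (any⁺; any⁻)
open import Data.Nat using (ℕ; zero; suc; _≤_)
open import Data.Product using (∃; _,_; proj₁; proj₂)
open import Data.Vec as V using (Vec; []; _∷_)
import Data.Vec.Properties as VP
open import Function using (_∘_; Equivalence; mk⇔)
open import Relation.Binary.PropositionalEquality
  using (_≡_; refl; sym; trans; cong; cong₂; subst; module ≡-Reasoning)
import Relation.Binary.PropositionalEquality as ≡

private
  variable
    k n N : ℕ
    A B : Set

module _ {p : A → Bool} where

  all≡true⁺ : ∀ xs → (∀ a → p a ≡ true) → all p xs ≡ true
  all≡true⁺ xs h = Equivalence.to T-≡ (all⁻ p (All.universal (Equivalence.from T-≡ ∘ h) xs))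

  all≡true⁻ : ∀ {xs a} → all p xs ≡ true → a ∈ xs → p a ≡ true
  all≡true⁻ {xs} h a∈xs = Equivalence.to T-≡ (All.lookup (all⁺ p xs (Equivalence.from T-≡ h)) a∈xs)

  any≡true⁺ : ∀ {xs a} → a ∈ xs → p a ≡ true → any p xs ≡ true
  any≡true⁺ a∈xs pa = Equivalence.to T-≡ (any⁺ p (lose a∈xs (Equivalence.from T-≡ pa)))

  any≡true⁻ : ∀ xs → any p xs ≡ true → ∃ λ a → p a ≡ true
  any≡true⁻ xs h =
    let a , pa = Any.satisfied (any⁻ p xs (Equivalence.from T-≡ h)) in a , Equivalence.to T-≡ pa

⇒≡true : ∀ {a b} → (a ≡ true → b ≡ true) → not a ∨ b ≡ true
⇒≡true {false} h = refl
⇒≡true {true}  h = h refl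

⇒≡true⁻ : ∀ {a b} → not a ∨ b ≡ true → a ≡ true → b ≡ true
⇒≡true⁻ {true} h refl = h

vecsOver-complete : ∀ {xs : List A} → (∀ a → a ∈ xs) → (v : Vec A n) → v ∈ vecsOver xs n
vecsOver-complete complete []      = here refl
vecsOver-complete complete (a ∷ v) =
  ∈-concatMap⁺ _ (lose (complete a) (∈-map⁺ (a ∷_) (vecsOver-complete complete v)))

allVecs-complete : (v : F2^ n) → v ∈ allVecs n
allVecs-complete = vecsOver-complete λ { false → here refl ; true → there (here refl) }

filterᵇ-lookup : (p : A → Bool) (xs : List A) (i : Fin (L.length (L.filterᵇ p xs))) →
  p (V.lookup (V.fromList (L.filterᵇ p xs)) i) ≡ true
filterᵇ-lookup p (x ∷ xs) i with p x in px
filterᵇ-lookup p (x ∷ xs) fzero    | true  = px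
filterᵇ-lookup p (x ∷ xs) (fsuc i) | true  = filterᵇ-lookup p xs i
filterᵇ-lookup p (x ∷ xs) i        | false = filterᵇ-lookup p xs i

lookup-ext : ∀ {u v : Vec A n} → (∀ i → V.lookup u i ≡ V.lookup v i) → u ≡ v
lookup-ext {u = u} {v} h =
  trans (sym (VP.tabulate∘lookup u)) (trans (VP.tabulate-cong h) (VP.tabulate∘lookup v))

columns : ∀ {m} → Vec (Vec A N) m → Vec (Vec A m) N
columns M = V.tabulate (λ j → V.map (λ r → V.lookup r j) M)

lookup-columns : ∀ {m} (M : Vec (Vec A N) m) j i →
  V.lookup (V.lookup (columns M) j) i ≡ V.lookup (V.lookup M i) j
lookup-columns M j i = trans (cong (λ c → V.lookup c i) (VP.lookup∘tabulate _ j)) (VP.lookup-map i _ M)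

columns-zipWith-∷ : ∀ {m} (u : Vec A m) (M : Vec (Vec A N) m) →
  columns (V.zipWith _∷_ u M) ≡ u ∷ columns M
columns-zipWith-∷ u M = cong₂ _∷_ (heads u M) (VP.tabulate-cong (tails u M))
  where
  heads : ∀ {m} (u : Vec A m) (M : Vec (Vec A N) m) →
    V.map (λ r → V.lookup r fzero) (V.zipWith _∷_ u M) ≡ u
  heads []      []      = refl
  heads (a ∷ u) (r ∷ M) = cong (a ∷_) (heads u M)

  tails : ∀ {m} (u : Vec A m) (M : Vec (Vec A N) m) j →
    V.map (λ r → V.lookup r (fsuc j)) (V.zipWith _∷_ u M) ≡ V.map (λ r → V.lookup r j) M
  tails []      []      j = refl
  tails (a ∷ u) (r ∷ M) j = cong (V.lookup r j ∷_) (tails u M j)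

_≗ᵇ_ : (F2^ n → Bool) → (F2^ n → Bool) → Bool
f ≗ᵇ D = all (λ w → f w ==ᵇ D w) (allVecs _)

glue : (F2^ n → Bool) → (F2^ n → Bool) → F2^ (suc n) → Bool
glue f₀ f₁ (b ∷ v) = if b then f₁ v else f₀ v

-- Finite sums over lists in a commutative monoid

module FiniteSum {c ℓ} (CM : CommutativeMonoid c ℓ) where

  open CommutativeMonoid CM renaming (refl to ≈-refl; sym to ≈-sym; trans to ≈-trans)
  open import Algebra.Properties.CommutativeSemigroup commutativeSemigroup using (interchange)
  open import Relation.Binary.Reasoning.Setoid setoid

  ∑ : List A → (A → Carrier) → Carrier
  ∑ xs f = L.foldr _∙_ ε (L.map f xs)

  syntax ∑ xs (λ a → e) = ∑[ a ← xs ] e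

  when : Bool → Carrier → Carrier
  when b y = if b then y else ε

  ∑-cong : ∀ (xs : List A) {f g} → (∀ a → f a ≈ g a) → ∑ xs f ≈ ∑ xs g
  ∑-cong []       f≈g = ≈-refl
  ∑-cong (a ∷ xs) f≈g = ∙-cong (f≈g a) (∑-cong xs f≈g)

  ∑-++ : ∀ (xs ys : List A) f → ∑ (xs ++ ys) f ≈ ∑ xs f ∙ ∑ ys f
  ∑-++ []       ys f = ≈-sym (identityˡ _)
  ∑-++ (a ∷ xs) ys f = ≈-trans (∙-cong ≈-refl (∑-++ xs ys f)) (≈-sym (assoc _ _ _))

  ∑-map : ∀ (xs : List A) (g : A → B) f → ∑ (L.map g xs) f ≡ ∑ xs (f ∘ g)
  ∑-map xs g f = cong (L.foldr _∙_ ε) (≡.sym (LP.map-∘ xs))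

  ∑-concatMap : ∀ (xs : List A) (g : A → List B) f →
    ∑ (L.concatMap g xs) f ≈ ∑[ a ← xs ] ∑ (g a) f
  ∑-concatMap []       g f = ≈-refl
  ∑-concatMap (a ∷ xs) g f = ≈-trans (∑-++ (g a) _ f) (∙-cong ≈-refl (∑-concatMap xs g f))

  ∑-ε : ∀ (xs : List A) → ∑[ _ ← xs ] ε ≈ ε
  ∑-ε []       = ≈-refl
  ∑-ε (a ∷ xs) = ≈-trans (identityˡ _) (∑-ε xs)

  ∑-distrib : ∀ (xs : List A) f g → ∑[ a ← xs ] (f a ∙ g a) ≈ ∑ xs f ∙ ∑ xs g
  ∑-distrib []       f g = ≈-sym (identityˡ _)
  ∑-distrib (a ∷ xs) f g = ≈-trans (∙-cong ≈-refl (∑-distrib xs f g)) (interchange _ _ _ _)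

  ∑-comm : ∀ (xs : List A) (ys : List B) (f : A → B → Carrier) →
    ∑[ a ← xs ] ∑ ys (f a) ≈ ∑[ b ← ys ] ∑[ a ← xs ] f a b
  ∑-comm []       ys f = ≈-sym (∑-ε ys)
  ∑-comm (a ∷ xs) ys f =
    ≈-trans (∙-cong ≈-refl (∑-comm xs ys f)) (≈-sym (∑-distrib ys (f a) λ b → ∑[ a ← xs ] f a b))

  ∑-filterᵇ : ∀ (p : A → Bool) xs f → ∑ (L.filterᵇ p xs) f ≈ ∑[ a ← xs ] when (p a) (f a)
  ∑-filterᵇ p []       f = ≈-refl
  ∑-filterᵇ p (x ∷ xs) f with p x
  ... | true  = ∙-cong ≈-refl (∑-filterᵇ p xs f)
  ... | false = ≈-trans (∑-filterᵇ p xs f) (≈-sym (identityˡ _))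

  ∑-when : ∀ b (xs : List A) f → when b (∑ xs f) ≈ ∑[ a ← xs ] when b (f a)
  ∑-when true  xs f = ≈-refl
  ∑-when false xs f = ≈-sym (∑-ε xs)

  when-cong : ∀ {a b y z} → a ≡ b → y ≈ z → when a y ≈ when b z
  when-cong {true}  refl y≈z = y≈z
  when-cong {false} refl _   = ≈-refl

  when-∧ : ∀ a b y → when (a ∧ b) y ≡ when a (when b y)
  when-∧ true  b y = refl
  when-∧ false b y = refl

  when-comm : ∀ a b y → when a (when b y) ≡ when b (when a y)
  when-comm true  b     y = refl
  when-comm false true  y = refl
  when-comm false false y = refl

  ∑-vecsOver-suc : ∀ (xs : List A) n f →
    ∑ (vecsOver xs (suc n)) f ≈ ∑[ a ← xs ] ∑[ v ← vecsOver xs n ] f (a ∷ v)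
  ∑-vecsOver-suc xs n f =
    ≈-trans (∑-concatMap xs _ f) (∑-cong xs λ a → reflexive (∑-map (vecsOver xs n) (a ∷_) f))

  ∑-vecsOver-singleton : ∀ (x : A) n f → ∑ (vecsOver (x ∷ []) n) f ≈ f (V.replicate n x)
  ∑-vecsOver-singleton x zero    f = identityʳ _
  ∑-vecsOver-singleton x (suc n) f =
    ≈-trans (∑-vecsOver-suc (x ∷ []) n f) (≈-trans (identityʳ _) (∑-vecsOver-singleton x n (f ∘ (x ∷_))))

  ∑-allVecs-suc : ∀ n f →
    ∑ (allVecs (suc n)) f ≈ ∑ (allVecs n) (f ∘ (false ∷_)) ∙ ∑ (allVecs n) (f ∘ (true ∷_))
  ∑-allVecs-suc n f = ≈-trans (∑-vecsOver-suc (false ∷ true ∷ []) n f) (∙-cong ≈-refl (identityʳ _))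

  ∑-allVecs-δ : ∀ n (u : F2^ n) y → ∑[ v ← allVecs n ] when (eqV v u) y ≈ y
  ∑-allVecs-δ zero    []          y = identityʳ y
  ∑-allVecs-δ (suc n) (false ∷ u) y = ≈-trans (∑-allVecs-suc n _)
    (≈-trans (∙-cong (∑-allVecs-δ n u y) (∑-ε (allVecs n))) (identityʳ y))
  ∑-allVecs-δ (suc n) (true ∷ u)  y = ≈-trans (∑-allVecs-suc n _)
    (≈-trans (∙-cong (∑-ε (allVecs n)) (∑-allVecs-δ n u y)) (identityˡ y))

  ∑-vecsOver-zipWith-∷ : ∀ (xs : List A) N m (G : Vec (Vec A (suc N)) m → Carrier) →
    ∑ (vecsOver (vecsOver xs (suc N)) m) G ≈
      ∑[ u ← vecsOver xs m ] ∑[ M ← vecsOver (vecsOver xs N) m ] G (V.zipWith _∷_ u M)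
  ∑-vecsOver-zipWith-∷ xs N zero    G = ≈-sym (identityʳ _)
  ∑-vecsOver-zipWith-∷ xs N (suc m) G = begin
    ∑ (vecsOver Rows (suc m)) G
      ≈⟨ ∑-vecsOver-suc Rows m G ⟩
    ∑[ r ← Rows ] ∑[ M ← vecsOver Rows m ] G (r ∷ M)
      ≈⟨ ∑-vecsOver-suc xs N _ ⟩
    ∑[ b ← xs ] ∑[ r ← vecsOver xs N ] ∑[ M ← vecsOver Rows m ] G ((b ∷ r) ∷ M)
      ≈⟨ ∑-cong xs (λ b → ∑-cong (vecsOver xs N) λ r → ∑-vecsOver-zipWith-∷ xs N m (G ∘ ((b ∷ r) ∷_))) ⟩
    ∑[ b ← xs ] ∑[ r ← vecsOver xs N ] ∑[ u ← vecsOver xs m ] ∑[ M ← Rows′ ] G ((b ∷ r) ∷ V.zipWith _∷_ u M)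
      ≈⟨ ∑-cong xs (λ b → ∑-comm (vecsOver xs N) (vecsOver xs m) _) ⟩
    ∑[ b ← xs ] ∑[ u ← vecsOver xs m ] ∑[ r ← vecsOver xs N ] ∑[ M ← Rows′ ] G ((b ∷ r) ∷ V.zipWith _∷_ u M)
      ≈⟨ ∑-cong xs (λ b → ∑-cong (vecsOver xs m) λ u → ≈-sym (∑-vecsOver-suc (vecsOver xs N) m _)) ⟩
    ∑[ b ← xs ] ∑[ u ← vecsOver xs m ] ∑[ M ← vecsOver (vecsOver xs N) (suc m) ] G (V.zipWith _∷_ (b ∷ u) M)
      ≈⟨ ≈-sym (∑-vecsOver-suc xs m _) ⟩
    ∑[ u ← vecsOver xs (suc m) ] ∑[ M ← vecsOver (vecsOver xs N) (suc m) ] G (V.zipWith _∷_ u M) ∎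
    where
    Rows  = vecsOver xs (suc N)
    Rows′ = vecsOver (vecsOver xs N) m

  ∑-columns : ∀ (xs : List A) m N (F : Vec (Vec A m) N → Carrier) →
    ∑ (vecsOver (vecsOver xs m) N) F ≈ ∑[ M ← vecsOver (vecsOver xs N) m ] F (columns M)
  ∑-columns xs m zero    F = ≈-trans (identityʳ _) (≈-sym (∑-vecsOver-singleton [] m (F ∘ columns)))
  ∑-columns xs m (suc N) F = begin
    ∑ (vecsOver (vecsOver xs m) (suc N)) F
      ≈⟨ ∑-vecsOver-suc (vecsOver xs m) N F ⟩
    ∑[ u ← vecsOver xs m ] ∑[ w ← vecsOver (vecsOver xs m) N ] F (u ∷ w)
      ≈⟨ ∑-cong (vecsOver xs m) (λ u → ∑-columns xs m N (F ∘ (u ∷_))) ⟩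
    ∑[ u ← vecsOver xs m ] ∑[ M ← vecsOver (vecsOver xs N) m ] F (u ∷ columns M)
      ≈⟨ ∑-cong (vecsOver xs m) (λ u → ∑-cong (vecsOver (vecsOver xs N) m) λ M →
           reflexive (cong F (≡.sym (columns-zipWith-∷ u M)))) ⟩
    ∑[ u ← vecsOver xs m ] ∑[ M ← vecsOver (vecsOver xs N) m ] F (columns (V.zipWith _∷_ u M))
      ≈⟨ ≈-sym (∑-vecsOver-zipWith-∷ xs N m (F ∘ columns)) ⟩
    ∑[ M ← vecsOver (vecsOver xs (suc N)) m ] F (columns M) ∎

-- all p xs is, by definition, the sum ∑ xs p in the monoid (Bool, ∧, true).
module ∧-Sum = FiniteSum ∧-commutativeMonoid

≗ᵇ-congʳ : (f : F2^ n → Bool) {D D′ : F2^ n → Bool} → (∀ w → D w ≡ D′ w) → f ≗ᵇ D ≡ f ≗ᵇ D′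
≗ᵇ-congʳ {n} f D≗D′ = ∧-Sum.∑-cong (allVecs n) λ w → cong (f w ==ᵇ_) (D≗D′ w)

≗ᵇ-glue : (f : F2^ (suc n) → Bool) (D₀ D₁ : F2^ n → Bool) →
  f ≗ᵇ glue D₀ D₁ ≡ (f ∘ (false ∷_)) ≗ᵇ D₀ ∧ (f ∘ (true ∷_)) ≗ᵇ D₁
≗ᵇ-glue {n} f D₀ D₁ = ∧-Sum.∑-allVecs-suc n (λ w → f w ==ᵇ glue D₀ D₁ w)

module SubsetSum {c ℓ} (CM : CommutativeMonoid c ℓ) where

  open CommutativeMonoid CM renaming (refl to ≈-refl; sym to ≈-sym; trans to ≈-trans)
  open FiniteSum CM
  open import Relation.Binary.Reasoning.Setoid setoid

  -- Subsets are characteristic functions, and there is no function extensionality.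
  Extensional : ((F2^ n → Bool) → Carrier) → Set ℓ
  Extensional h = ∀ {D D′} → (∀ w → D w ≡ D′ w) → h D ≈ h D′

  ∑-allSubsets-suc : ∀ n (g : (F2^ (suc n) → Bool) → Carrier) → Extensional g →
    ∑ (allSubsets (suc n)) g ≈ ∑[ D₀ ← allSubsets n ] ∑[ D₁ ← allSubsets n ] g (glue D₀ D₁)
  ∑-allSubsets-suc n g ext =
    ≈-trans (∑-concatMap (allSubsets n) _ g) (∑-cong (allSubsets n) λ D₀ →
      ≈-trans (reflexive (∑-map (allSubsets n) _ g)) (∑-cong (allSubsets n) λ D₁ →
        ext λ { (false ∷ v) → refl ; (true ∷ v) → refl }))

  ∑-allSubsets-≗ᵇ : ∀ n (f : F2^ n → Bool) (h : (F2^ n → Bool) → Carrier) → Extensional h →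
    ∑[ D ← allSubsets n ] when (f ≗ᵇ D) (h D) ≈ h f
  ∑-allSubsets-≗ᵇ zero f h ext with f [] in f[]
  ... | false = ≈-trans (∙-cong (ext λ { [] → ≡.sym f[] }) (identityˡ ε)) (identityʳ _)
  ... | true  = ≈-trans (identityˡ _) (≈-trans (identityʳ _) (ext λ { [] → ≡.sym f[] }))
  ∑-allSubsets-≗ᵇ (suc n) f h ext = begin
    ∑[ D ← allSubsets (suc n) ] when (f ≗ᵇ D) (h D)
      ≈⟨ ∑-allSubsets-suc n _ (λ D≗D′ → when-cong (≗ᵇ-congʳ f D≗D′) (ext D≗D′)) ⟩
    ∑[ D₀ ← S ] ∑[ D₁ ← S ] when (f ≗ᵇ glue D₀ D₁) (h (glue D₀ D₁))
      ≈⟨ ∑-cong S (λ D₀ → ∑-cong S λ D₁ →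
           reflexive (trans (cong (λ b → when b _) (≗ᵇ-glue f D₀ D₁))
                            (when-∧ (f₀ ≗ᵇ D₀) (f₁ ≗ᵇ D₁) (h (glue D₀ D₁))))) ⟩
    ∑[ D₀ ← S ] ∑[ D₁ ← S ] when (f₀ ≗ᵇ D₀) (when (f₁ ≗ᵇ D₁) (h (glue D₀ D₁)))
      ≈⟨ ∑-cong S (λ D₀ → ≈-sym (∑-when (f₀ ≗ᵇ D₀) S _)) ⟩
    ∑[ D₀ ← S ] when (f₀ ≗ᵇ D₀) (∑[ D₁ ← S ] when (f₁ ≗ᵇ D₁) (h (glue D₀ D₁)))
      ≈⟨ ∑-cong S (λ D₀ → when-cong refl (∑-allSubsets-≗ᵇ n f₁ (h ∘ glue D₀)
           λ e → ext λ { (false ∷ v) → refl ; (true ∷ v) → e v })) ⟩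
    ∑[ D₀ ← S ] when (f₀ ≗ᵇ D₀) (h (glue D₀ f₁))
      ≈⟨ ∑-allSubsets-≗ᵇ n f₀ (λ D₀ → h (glue D₀ f₁))
           (λ e → ext λ { (false ∷ v) → e v ; (true ∷ v) → refl }) ⟩
    h (glue f₀ f₁)
      ≈⟨ ext (λ { (false ∷ v) → refl ; (true ∷ v) → refl }) ⟩
    h f ∎
    where
    S  = allSubsets n
    f₀ = f ∘ (false ∷_)
    f₁ = f ∘ (true ∷_)

  ∑-allSubsets-fibres : (P : (F2^ n → Bool) → Bool) → (∀ {D D′} → (∀ w → D w ≡ D′ w) → P D ≡ P D′) →
    (σ : B → F2^ n → Bool) (ys : List B) (g : B → Carrier) →
    ∑[ D ← allSubsets n ] when (P D) (∑[ b ← ys ] when (σ b ≗ᵇ D) (g b)) ≈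
      ∑[ b ← ys ] when (P (σ b)) (g b)
  ∑-allSubsets-fibres {n} P P-cong σ ys g = begin
    ∑[ D ← Ds ] when (P D) (∑[ b ← ys ] when (σ b ≗ᵇ D) (g b))
      ≈⟨ ∑-cong Ds (λ D → ∑-when (P D) ys _) ⟩
    ∑[ D ← Ds ] ∑[ b ← ys ] when (P D) (when (σ b ≗ᵇ D) (g b))
      ≈⟨ ∑-comm Ds ys _ ⟩
    ∑[ b ← ys ] ∑[ D ← Ds ] when (P D) (when (σ b ≗ᵇ D) (g b))
      ≈⟨ ∑-cong ys (λ b → ∑-cong Ds λ D → reflexive (when-comm (P D) (σ b ≗ᵇ D) (g b))) ⟩
    ∑[ b ← ys ] ∑[ D ← Ds ] when (σ b ≗ᵇ D) (when (P D) (g b))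
      ≈⟨ ∑-cong ys (λ b → ∑-allSubsets-≗ᵇ n (σ b) (λ D → when (P D) (g b))
           λ e → when-cong (P-cong e) ≈-refl) ⟩
    ∑[ b ← ys ] when (P (σ b)) (g b) ∎
    where
    Ds = allSubsets n

-- Linear algebra over F₂

eqV-refl : (u : F2^ n) → eqV u u ≡ true
eqV-refl []          = refl
eqV-refl (false ∷ u) = eqV-refl u
eqV-refl (true ∷ u)  = eqV-refl u

eqV-sound : {u v : F2^ n} → eqV u v ≡ true → u ≡ v
eqV-sound {u = []}        {[]}        _ = refl
eqV-sound {u = false ∷ u} {false ∷ v} e = cong (false ∷_) (eqV-sound e)
eqV-sound {u = true ∷ u}  {true ∷ v}  e = cong (true ∷_) (eqV-sound e)

⊕-assoc : (u v w : F2^ n) → (u ⊕ v) ⊕ w ≡ u ⊕ (v ⊕ w)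
⊕-assoc = VP.zipWith-assoc xor-assoc

⊕-comm : (u v : F2^ n) → u ⊕ v ≡ v ⊕ u
⊕-comm = VP.zipWith-comm xor-comm

⊕-identityˡ : (u : F2^ n) → zeroV n ⊕ u ≡ u
⊕-identityˡ = VP.zipWith-identityˡ xor-identityˡ

⊕-identityʳ : (u : F2^ n) → u ⊕ zeroV n ≡ u
⊕-identityʳ = VP.zipWith-identityʳ xor-identityʳ

⊕-self : (u : F2^ n) → u ⊕ u ≡ zeroV n
⊕-self []      = refl
⊕-self (a ∷ u) = cong₂ _∷_ (xor-same a) (⊕-self u)

⊕-interchange : (p q r s : F2^ n) → (p ⊕ q) ⊕ (r ⊕ s) ≡ (p ⊕ r) ⊕ (q ⊕ s)
⊕-interchange p q r s = begin
  (p ⊕ q) ⊕ (r ⊕ s) ≡⟨ ⊕-assoc p q (r ⊕ s) ⟩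
  p ⊕ (q ⊕ (r ⊕ s)) ≡⟨ cong (p ⊕_) (sym (⊕-assoc q r s)) ⟩
  p ⊕ ((q ⊕ r) ⊕ s) ≡⟨ cong (λ z → p ⊕ (z ⊕ s)) (⊕-comm q r) ⟩
  p ⊕ ((r ⊕ q) ⊕ s) ≡⟨ cong (p ⊕_) (⊕-assoc r q s) ⟩
  p ⊕ (r ⊕ (q ⊕ s)) ≡⟨ sym (⊕-assoc p r (q ⊕ s)) ⟩
  (p ⊕ r) ⊕ (q ⊕ s) ∎
  where open ≡-Reasoning

lookup-zeroV : (i : Fin n) → V.lookup (zeroV n) i ≡ false
lookup-zeroV i = VP.lookup-replicate i false

lookup-⊕ : (u v : F2^ n) (i : Fin n) → V.lookup (u ⊕ v) i ≡ V.lookup u i xor V.lookup v i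
lookup-⊕ u v i = VP.lookup-zipWith _xor_ i u v

lookup-if : ∀ b (u : F2^ n) i → V.lookup (if b then u else zeroV n) i ≡ b ∧ V.lookup u i
lookup-if true  u i = refl
lookup-if false u i = lookup-zeroV i

if-xor : ∀ a b (u : F2^ n) →
  (if a xor b then u else zeroV n) ≡ (if a then u else zeroV n) ⊕ (if b then u else zeroV n)
if-xor false b     u = sym (⊕-identityˡ _)
if-xor true  false u = sym (⊕-identityʳ u)
if-xor true  true  u = sym (⊕-self u)

lincomb-zeroV : (rs : Vec (F2^ n) k) → lincomb (zeroV k) rs ≡ zeroV n
lincomb-zeroV []       = refl
lincomb-zeroV (r ∷ rs) = trans (⊕-identityˡ _) (lincomb-zeroV rs)

lincomb-⊕ : (a b : F2^ k) (rs : Vec (F2^ n) k) → lincomb (a ⊕ b) rs ≡ lincomb a rs ⊕ lincomb b rs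
lincomb-⊕ []      []      []       = sym (⊕-identityˡ _)
lincomb-⊕ (x ∷ a) (y ∷ b) (r ∷ rs) =
  trans (cong₂ _⊕_ (if-xor x y r) (lincomb-⊕ a b rs)) (⊕-interchange _ _ _ _)

unitV : Fin k → F2^ k
unitV {suc k} fzero    = true ∷ zeroV k
unitV         (fsuc i) = false ∷ unitV i

lincomb-unitV : (rs : Vec (F2^ n) k) (i : Fin k) → lincomb (unitV i) rs ≡ V.lookup rs i
lincomb-unitV (r ∷ rs) fzero    = trans (cong (r ⊕_) (lincomb-zeroV rs)) (⊕-identityʳ r)
lincomb-unitV (r ∷ rs) (fsuc i) = trans (⊕-identityˡ _) (lincomb-unitV rs i)

lincomb-∈ : ∀ {r : F2^ n} {xs} → r ∈ xs → ∃ λ e → lincomb e (V.fromList xs) ≡ r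
lincomb-∈ {xs = x ∷ xs} (here refl) = unitV fzero , lincomb-unitV (V.fromList (x ∷ xs)) fzero
lincomb-∈ (there r∈xs) = let e , eq = lincomb-∈ r∈xs in false ∷ e , trans (⊕-identityˡ _) eq

lincomb-closed : {C : F2^ N → Bool} → IsLinearCode C → (rs : Vec (F2^ N) k) →
  (∀ i → C (V.lookup rs i) ≡ true) → ∀ c → C (lincomb c rs) ≡ true
lincomb-closed lin []       _  []      = IsLinearCode.zero∈ lin
lincomb-closed {N = N} {C = C} lin (r ∷ rs) rs⊆C (a ∷ c) =
  IsLinearCode.⊕-closed lin _ _ (scaled a) (lincomb-closed lin rs (rs⊆C ∘ fsuc) c)
  where
  scaled : ∀ a → C (if a then r else zeroV N) ≡ true
  scaled true  = rs⊆C fzero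
  scaled false = IsLinearCode.zero∈ lin

inSpan⁺ : (rs : Vec (F2^ n) k) (c : F2^ k) {w : F2^ n} → lincomb c rs ≡ w → inSpanᵇ rs w ≡ true
inSpan⁺ rs c refl = any≡true⁺ (allVecs-complete c) (eqV-refl (lincomb c rs))

inSpan⁻ : (rs : Vec (F2^ n) k) {w : F2^ n} → inSpanᵇ rs w ≡ true → ∃ λ c → lincomb c rs ≡ w
inSpan⁻ {k = k} rs h = let c , e = any≡true⁻ (allVecs k) h in c , eqV-sound e

inSpan-isLinearCode : (rs : Vec (F2^ n) k) → IsLinearCode (inSpanᵇ rs)
inSpan-isLinearCode rs = record
  { zero∈    = inSpan⁺ rs (zeroV _) (lincomb-zeroV rs)
  ; ⊕-closed = λ u v u∈ v∈ →
      let c , cu = inSpan⁻ rs u∈ ; d , dv = inSpan⁻ rs v∈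
      in inSpan⁺ rs (c ⊕ d) (trans (lincomb-⊕ c d rs) (cong₂ _⊕_ cu dv))
  }

isLinearᵇ⁺ : {D : F2^ n → Bool} → IsLinearCode D → isLinearᵇ D ≡ true
isLinearᵇ⁺ {n} {D} lin rewrite IsLinearCode.zero∈ lin =
  all≡true⁺ (allVecs n) λ u → all≡true⁺ (allVecs n) λ v →
    ⇒≡true λ u∈ → ⇒≡true λ v∈ → IsLinearCode.⊕-closed lin u v u∈ v∈

subsetᵇ⁺ : {D C : F2^ n → Bool} → (∀ u → D u ≡ true → C u ≡ true) → subsetᵇ D C ≡ true
subsetᵇ⁺ {n} D⊆C = all≡true⁺ (allVecs n) (λ u → ⇒≡true (D⊆C u))

subsetᵇ⁻ : {D C : F2^ n → Bool} → subsetᵇ D C ≡ true → ∀ u → D u ≡ true → C u ≡ true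
subsetᵇ⁻ h u = ⇒≡true⁻ (all≡true⁻ h (allVecs-complete u))

rowsIn : (F2^ N → Bool) → Vec (F2^ N) k → Bool
rowsIn C []      = true
rowsIn C (r ∷ M) = C r ∧ rowsIn C M

rowsIn⁺ : {C : F2^ N → Bool} (M : Vec (F2^ N) k) →
  (∀ i → C (V.lookup M i) ≡ true) → rowsIn C M ≡ true
rowsIn⁺ []      h = refl
rowsIn⁺ (r ∷ M) h rewrite h fzero = rowsIn⁺ M (h ∘ fsuc)

rowsIn⁻ : {C : F2^ N → Bool} (M : Vec (F2^ N) k) →
  rowsIn C M ≡ true → ∀ i → C (V.lookup M i) ≡ true
rowsIn⁻ {C = C} (r ∷ M) h i with C r in Cr
rowsIn⁻ (r ∷ M) h fzero    | true = Cr
rowsIn⁻ (r ∷ M) h (fsuc i) | true = rowsIn⁻ M h i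

spanWithOnes : Vec (F2^ N) k → F2^ N → Bool
spanWithOnes M = inSpanᵇ (onesV _ ∷ M)

subcodeWithOnesᵇ : (F2^ N → Bool) → (F2^ N → Bool) → Bool
subcodeWithOnesᵇ C D = isLinearᵇ D ∧ D (onesV _) ∧ subsetᵇ D C

subcodeWithOnesᵇ-cong : (C : F2^ N → Bool) {D D′ : F2^ N → Bool} → (∀ w → D w ≡ D′ w) →
  subcodeWithOnesᵇ C D ≡ subcodeWithOnesᵇ C D′
subcodeWithOnesᵇ-cong {N} C D≗D′ =
  cong₂ _∧_
    (cong₂ _∧_ (D≗D′ (zeroV N))
      (∧-Sum.∑-cong (allVecs N) λ u → ∧-Sum.∑-cong (allVecs N) λ v →
        cong₂ (λ a b → not a ∨ b) (D≗D′ u) (cong₂ (λ a b → not a ∨ b) (D≗D′ v) (D≗D′ (u ⊕ v)))))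
    (cong₂ _∧_ (D≗D′ (onesV N)) (∧-Sum.∑-cong (allVecs N) λ u → cong (λ b → not b ∨ C u) (D≗D′ u)))

ones∈spanWithOnes : (M : Vec (F2^ N) k) → spanWithOnes M (onesV N) ≡ true
ones∈spanWithOnes {N} M = inSpan⁺ (onesV N ∷ M) (unitV fzero) (lincomb-unitV (onesV N ∷ M) fzero)

subsetᵇ-spanWithOnes : {C : F2^ N → Bool} → IsLinearCode C → C (onesV N) ≡ true →
  (M : Vec (F2^ N) k) → subsetᵇ (spanWithOnes M) C ≡ rowsIn C M
subsetᵇ-spanWithOnes {N} {C = C} lin ones∈C M = ⇔→≡ (mk⇔ rows⊆C span⊆C)
  where
  rows⊆C : subsetᵇ (spanWithOnes M) C ≡ true → rowsIn C M ≡ true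
  rows⊆C h = rowsIn⁺ M λ i →
    subsetᵇ⁻ {D = spanWithOnes M} h _
      (inSpan⁺ (onesV N ∷ M) (unitV (fsuc i)) (lincomb-unitV (onesV N ∷ M) (fsuc i)))

  span⊆C : rowsIn C M ≡ true → subsetᵇ (spanWithOnes M) C ≡ true
  span⊆C h = subsetᵇ⁺ {D = spanWithOnes M} λ u u∈ →
    let c , eq = inSpan⁻ _ u∈ in subst (λ w → C w ≡ true) eq (lincomb-closed lin _ generators⊆C c)
    where
    generators⊆C : ∀ i → C (V.lookup (onesV N ∷ M) i) ≡ true
    generators⊆C fzero    = ones∈C
    generators⊆C (fsuc i) = rowsIn⁻ M h i

subcodeWithOnesᵇ-spanWithOnes : {C : F2^ N → Bool} → IsLinearCode C → C (onesV N) ≡ true →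
  (M : Vec (F2^ N) k) → subcodeWithOnesᵇ C (spanWithOnes M) ≡ rowsIn C M
subcodeWithOnesᵇ-spanWithOnes {C = C} lin ones∈C M = begin
  isLinearᵇ S ∧ S (onesV _) ∧ subsetᵇ S C
    ≡⟨ cong₂ (λ a b → a ∧ b ∧ subsetᵇ S C)
             (isLinearᵇ⁺ (inSpan-isLinearCode (onesV _ ∷ M))) (ones∈spanWithOnes M) ⟩
  subsetᵇ S C
    ≡⟨ subsetᵇ-spanWithOnes lin ones∈C M ⟩
  rowsIn C M ∎
  where
  open ≡-Reasoning
  S = spanWithOnes M

-- The code C(m) and its words as matrices

column-columns : ∀ {m} (E : Vec (F2^ N) m) (i : Fin m) → column (columns E) i ≡ V.lookup E i
column-columns E i = lookup-ext λ k → trans (VP.lookup-map k _ (columns E)) (lookup-columns E k i)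

lookup-tensorComb : ∀ {m K} (ls : Vec (F2^ m) K) (cs : Vec (F2^ N) K) j i →
  V.lookup (V.lookup (tensorComb ls cs) j) i ≡ V.lookup (lincomb (column ls i) cs) j
lookup-tensorComb {N} {m} [] [] j i = begin
  V.lookup (V.lookup (V.replicate N (zeroV m)) j) i
    ≡⟨ cong (λ z → V.lookup z i) (VP.lookup-replicate j (zeroV m)) ⟩
  V.lookup (zeroV m) i ≡⟨ lookup-zeroV i ⟩
  false                ≡⟨ sym (lookup-zeroV j) ⟩
  V.lookup (zeroV N) j ∎
  where open ≡-Reasoning
lookup-tensorComb {N} (l ∷ ls) (c ∷ cs) j i = begin
  V.lookup (V.lookup (V.zipWith _⊕_ (scaleWord l c) (tensorComb ls cs)) j) i
    ≡⟨ cong (λ z → V.lookup z i) (VP.lookup-zipWith _⊕_ j (scaleWord l c) (tensorComb ls cs)) ⟩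
  V.lookup (V.lookup (scaleWord l c) j ⊕ V.lookup (tensorComb ls cs) j) i
    ≡⟨ lookup-⊕ (V.lookup (scaleWord l c) j) _ i ⟩
  V.lookup (V.lookup (scaleWord l c) j) i xor V.lookup (V.lookup (tensorComb ls cs) j) i
    ≡⟨ cong₂ _xor_ scaled (lookup-tensorComb ls cs j i) ⟩
  V.lookup (if V.lookup l i then c else zeroV N) j xor V.lookup (lincomb (column ls i) cs) j
    ≡⟨ sym (lookup-⊕ (if V.lookup l i then c else zeroV N) _ j) ⟩
  V.lookup (lincomb (column (l ∷ ls) i) (c ∷ cs)) j ∎
  where
  open ≡-Reasoning
  scaled : V.lookup (V.lookup (scaleWord l c) j) i ≡ V.lookup (if V.lookup l i then c else zeroV N) j
  scaled = begin
    V.lookup (V.lookup (scaleWord l c) j) i          ≡⟨ cong (λ z → V.lookup z i) (VP.lookup-map j _ c) ⟩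
    V.lookup (if V.lookup c j then l else zeroV _) i ≡⟨ lookup-if (V.lookup c j) l i ⟩
    V.lookup c j ∧ V.lookup l i                      ≡⟨ ∧-comm (V.lookup c j) (V.lookup l i) ⟩
    V.lookup l i ∧ V.lookup c j                      ≡⟨ sym (lookup-if (V.lookup l i) c j) ⟩
    V.lookup (if V.lookup l i then c else zeroV N) j ∎

module _ {m K : ℕ} (ls : Vec (F2^ m) K) (cs : Vec (F2^ N) K) (M : Vec (F2^ N) m) where

  tensorComb≡columns⁺ : (∀ i → lincomb (column ls i) cs ≡ V.lookup M i) → tensorComb ls cs ≡ columns M
  tensorComb≡columns⁺ h = lookup-ext λ j → lookup-ext λ i →
    trans (lookup-tensorComb ls cs j i)
          (trans (cong (λ r → V.lookup r j) (h i)) (sym (lookup-columns M j i)))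

  tensorComb≡columns⁻ : tensorComb ls cs ≡ columns M → ∀ i → lincomb (column ls i) cs ≡ V.lookup M i
  tensorComb≡columns⁻ eq i = lookup-ext λ j →
    trans (sym (lookup-tensorComb ls cs j i))
          (trans (cong (λ w → V.lookup (V.lookup w j) i) eq) (lookup-columns M j i))

module _ {m : ℕ} (C : F2^ N → Bool) where

  private
    codewords : List (F2^ N)
    codewords = L.filterᵇ C (allVecs N)

    cs : Vec (F2^ N) (L.length codewords)
    cs = V.fromList codewords

  inCmᵇ⁺ : (ls : Vec (F2^ m) (L.length codewords)) {w : Vec (F2^ m) N} →
    tensorComb ls cs ≡ w → inCmᵇ C w ≡ true
  inCmᵇ⁺ ls refl = any≡true⁺ (vecsOver-complete allVecs-complete ls)
    (all≡true⁺ (L.allFin N) λ j → eqV-refl (V.lookup (tensorComb ls cs) j))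

  inCmᵇ⁻ : (w : Vec (F2^ m) N) → inCmᵇ C w ≡ true → ∃ λ ls → tensorComb ls cs ≡ w
  inCmᵇ⁻ w h = let ls , ls↦w = any≡true⁻ (vecsOver (allVecs m) _) h
               in ls , lookup-ext λ j → eqV-sound (all≡true⁻ ls↦w (∈-allFin j))

  inCmᵇ-columns : IsLinearCode C → (M : Vec (F2^ N) m) → inCmᵇ C (columns M) ≡ rowsIn C M
  inCmᵇ-columns lin M = ⇔→≡ (mk⇔ rows⊆C fromRows)
    where
    rows⊆C : inCmᵇ C (columns M) ≡ true → rowsIn C M ≡ true
    rows⊆C h = let ls , eq = inCmᵇ⁻ (columns M) h in rowsIn⁺ M λ i →
      subst (λ r → C r ≡ true) (tensorComb≡columns⁻ ls cs M eq i)
        (lincomb-closed lin cs (filterᵇ-lookup C (allVecs N)) (column ls i))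

    fromRows : rowsIn C M ≡ true → inCmᵇ C (columns M) ≡ true
    fromRows h = inCmᵇ⁺ (columns E) (tensorComb≡columns⁺ (columns E) cs M λ i →
        trans (cong (λ c → lincomb c cs) (column-columns E i))
              (trans (cong (λ c → lincomb c cs) (VP.lookup∘tabulate _ i)) (proj₂ (coefficients i))))
      where
      coefficients : ∀ i → ∃ λ e → lincomb e cs ≡ V.lookup M i
      coefficients i =
        lincomb-∈ (∈-filter⁺ _ (allVecs-complete _) (Equivalence.from T-≡ (rowsIn⁻ M h i)))

      E : Vec (F2^ (L.length codewords)) m
      E = V.tabulate (proj₁ ∘ coefficients)

-- Both sides as sums over matrices

module _ {c ℓ} (R : CommutativeSemiring c ℓ) where

  open CommutativeSemiring R renaming (refl to ≈-refl; sym to ≈-sym; trans to ≈-trans)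
  open Poly R
  open FiniteSum +-commutativeMonoid
  open SubsetSum +-commutativeMonoid using (∑-allSubsets-fibres)
  module Π = FiniteSum *-commutativeMonoid
  open import Relation.Binary.Reasoning.Setoid setoid

  module _ {m : ℕ} (x : F2^ m → Carrier) where

    pow-count-∷ : (u v : F2^ m) (w : Vec (F2^ m) N) →
      pow (x v) (count v (u ∷ w)) ≈ Π.when (eqV v u) (x u) * pow (x v) (count v w)
    pow-count-∷ u v w with eqV v u in v≡u
    ... | true  = *-cong (reflexive (cong x (eqV-sound v≡u))) ≈-refl
    ... | false = ≈-sym (*-identityˡ _)

    monomial-∷ : (u : F2^ m) (w : Vec (F2^ m) N) → monomial x (u ∷ w) ≈ x u * monomial x w
    monomial-∷ u w = begin
      monomial x (u ∷ w)
        ≈⟨ Π.∑-cong (allVecs m) (λ v → pow-count-∷ u v w) ⟩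
      Π.∑ (allVecs m) (λ v → Π.when (eqV v u) (x u) * pow (x v) (count v w))
        ≈⟨ Π.∑-distrib (allVecs m) _ _ ⟩
      Π.∑ (allVecs m) (λ v → Π.when (eqV v u) (x u)) * monomial x w
        ≈⟨ *-cong (Π.∑-allVecs-δ m u (x u)) ≈-refl ⟩
      x u * monomial x w ∎

    monomial-tabulate : (w : Vec (F2^ m) N) → monomial x w ≈ prodL (L.tabulate (x ∘ V.lookup w))
    monomial-tabulate []      = Π.∑-ε (allVecs m)
    monomial-tabulate (u ∷ w) = ≈-trans (monomial-∷ u w) (*-cong ≈-refl (monomial-tabulate w))

    monomial-columns : (M : Vec (F2^ N) m) → monomial x (columns M) ≈ μM x M
    monomial-columns M = begin
      monomial x (columns M)
        ≈⟨ monomial-tabulate (columns M) ⟩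
      prodL (L.tabulate (x ∘ V.lookup (columns M)))
        ≡⟨ cong prodL (LP.tabulate-cong λ j → cong x (VP.lookup∘tabulate (column M) j)) ⟩
      prodL (L.tabulate (x ∘ column M))
        ≡⟨ cong prodL (sym (LP.map-tabulate (λ j → j) (x ∘ column M))) ⟩
      μM x M ∎

    cwe-≈-∑-rowsIn : {C : F2^ N → Bool} → IsLinearCode C →
      cwe x C ≈ ∑[ M ← vecsOver (allVecs N) m ] when (rowsIn C M) (μM x M)
    cwe-≈-∑-rowsIn {N} {C} lin = begin
      cwe x C
        ≈⟨ ∑-filterᵇ (inCmᵇ C) (vecsOver (allVecs m) N) (monomial x) ⟩
      ∑[ w ← vecsOver (allVecs m) N ] when (inCmᵇ C w) (monomial x w)
        ≈⟨ ∑-columns (false ∷ true ∷ []) m N _ ⟩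
      ∑[ M ← vecsOver (allVecs N) m ] when (inCmᵇ C (columns M)) (monomial x (columns M))
        ≈⟨ ∑-cong (vecsOver (allVecs N) m) (λ M →
             when-cong (inCmᵇ-columns C lin M) (monomial-columns M)) ⟩
      ∑[ M ← vecsOver (allVecs N) m ] when (rowsIn C M) (μM x M) ∎

    sumμSubcodes-≈-∑-rowsIn : {C : F2^ N → Bool} → IsLinearCode C → C (onesV N) ≡ true →
      sumμSubcodes x C ≈ ∑[ M ← vecsOver (allVecs N) m ] when (rowsIn C M) (μM x M)
    sumμSubcodes-≈-∑-rowsIn {N} {C} lin ones∈C = begin
      sumμSubcodes x C
        ≈⟨ ∑-filterᵇ (subcodeWithOnesᵇ C) (allSubsets N) (μ x) ⟩
      ∑[ D ← allSubsets N ] when (subcodeWithOnesᵇ C D) (μ x D)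
        ≈⟨ ∑-cong (allSubsets N) (λ D → when-cong refl (∑-filterᵇ (λ M → spanEqᵇ M D) Ms (μM x))) ⟩
      ∑[ D ← allSubsets N ] when (subcodeWithOnesᵇ C D) (∑[ M ← Ms ] when (spanEqᵇ M D) (μM x M))
        ≈⟨ ∑-allSubsets-fibres (subcodeWithOnesᵇ C) (subcodeWithOnesᵇ-cong C) spanWithOnes Ms (μM x) ⟩
      ∑[ M ← Ms ] when (subcodeWithOnesᵇ C (spanWithOnes M)) (μM x M)
        ≈⟨ ∑-cong Ms (λ M → when-cong (subcodeWithOnesᵇ-spanWithOnes lin ones∈C M) ≈-refl) ⟩
      ∑[ M ← Ms ] when (rowsIn C M) (μM x M) ∎
      where
      Ms = vecsOver (allVecs N) m

lemma4p5 : ∀ {c ℓ} (R : CommutativeSemiring c ℓ) (m N : ℕ) → 1 ≤ m →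
    (C : F2^ N → Bool) → IsLinearCode C → SelfOrthogonal C → C (onesV N) ≡ true →
    (x : F2^ m → CommutativeSemiring.Carrier R) →
    CommutativeSemiring._≈_ R (Poly.cwe R x C) (Poly.sumμSubcodes R x C)
lemma4p5 R m N _ C lin _ ones∈C x =
  ≈-trans (cwe-≈-∑-rowsIn R x lin) (≈-sym (sumμSubcodes-≈-∑-rowsIn R x lin ones∈C))
  where open CommutativeSemiring R using () renaming (trans to ≈-trans; sym to ≈-sym)
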